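{- For any integers $k,\ell,t\geqslant 2$ and any positive integer $m<\ell$, setting $r=(k-1)\ell+m$, there exists a Cayley digraph that has diameter $k$, outdegree $t^\ell+(r-1)t^m-1$, and order $r\,t^r$.
   Context: For a group $G$ and a subset $S\subseteq G$ not containing the identity, the Cayley digraph of $G$ generated by $S$ has vertex set $G$ and a directed edge from $g$ to $gs$ for every $g\in G$ and $s\in S$; it is regular of outdegree $|S|$. Its order is $|G|$, and its diameter is the maximum over ordered pairs of vertices of the length of a shortest directed path from the first to the second. -}

module Defs where

open import Data.Nat using (ℕ; _≤_; _<_)
open import Data.Fin using (Fin)
open import Data.Fin.Subset using (Subset; _∈_)
open import Data.List using (List; length; foldl)
open import Data.List.Relation.Unary.All using (All)
open import Data.Product using (Σ; ∃; _×_)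
open import Relation.Nullary using (¬_)
open import Relation.Binary.PropositionalEquality using (_≡_)
open import Algebra.Structures using (IsGroup)

-- A finite group, presented (up to isomorphism) on the carrier Fin order.
record FinGroup : Set where
  field
    order   : ℕ
    _∙_     : Fin order → Fin order → Fin order
    ε       : Fin order
    _⁻¹     : Fin order → Fin order
    isGroup : IsGroup _≡_ _∙_ ε _⁻¹

open FinGroup public

-- In the Cayley digraph Cay(G,S) (edges g → g s, s ∈ S), there is a directed
-- walk of length d from g to h: a word s₁ … s_d over S with g s₁ ⋯ s_d = h.
WalkOfLength : (G : FinGroup) → Subset (order G) → ℕ → Fin (order G) → Fin (order G) → Set
WalkOfLength G S d g h =
  Σ (List (Fin (order G))) λ ss →
    (length ss ≡ d) × All (λ s → s ∈ S) ss × (foldl (_∙_ G) g ss ≡ h)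

DistAtMost : (G : FinGroup) → Subset (order G) → ℕ → Fin (order G) → Fin (order G) → Set
DistAtMost G S d g h = Σ ℕ λ e → (e ≤ d) × WalkOfLength G S e g h

HasDiameter : (G : FinGroup) → Subset (order G) → ℕ → Set
HasDiameter G S k =
  (∀ g h → DistAtMost G S k g h) ×
  (Σ (Fin (order G)) λ g → Σ (Fin (order G)) λ h →
     ∀ e → e < k → ¬ WalkOfLength G S e g h)

-- Take G = ℤₜ ≀ ℤᵣ with r = q ℓ + m and q = k - 1, whose elements are pairs (i , x) of a
-- rotation i ∈ ℤᵣ and a vector x ∈ ℤₜ^r, and let S consist of the (ℓ , y) with y supported on
-- the last ℓ coordinates (t ^ ℓ elements) together with the non-identity (i , y), i ≠ ℓ, with
-- y supported on the last m coordinates ((r - 1) t ^ m - 1 elements).  Right multiplication by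
-- (ℓ , y) copies ℓ further coordinates of a target x into place and rotates by ℓ, so q such
-- steps followed by one generator of the second kind, which copies the last m coordinates and
-- fixes the rotation, reach every element.  Conversely the number of nonzero coordinates is
-- subadditive and invariant under rotation, so each step raises it by at most ℓ, and
-- (0 , 1 … 1), with r > q ℓ nonzero coordinates, is not reached from the identity in fewer
-- than k steps.
module Submission where

open import Defs
open import Level using (0ℓ)
open import Algebra.Bundles using (Group)
open import Algebra.Core using (Op₁; Op₂)
open import Algebra.Structures using (IsGroup)
open import Algebra.Morphism.Structures using (IsGroupMonomorphism)
import Algebra.Morphism.GroupMonomorphism as GroupMonomorphism
import Algebra.Properties.Group as GroupProperties
open import Data.Bool using (true; false; _∧_; if_then_else_)
open import Data.Bool.Properties using (T-≡; T-∧)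
open import Data.Nat using (ℕ; zero; suc; _+_; _*_; _∸_; _^_; _⊓_; _≤_; _<_; z≤n; s≤s; _≤?_; _<ᵇ_; _≤ᵇ_)
open import Data.Nat.Properties
open import Data.Nat.DivMod using (_%_; m%n<n; m%n%n≡m%n; %-distribˡ-+; m<n⇒m%n≡m; n%n≡0; [m+n]%n≡m%n)
open import Algebra.Properties.CommutativeMonoid.Sum +-0-commutativeMonoid
  using (sum; ∑-distrib-+; sum-permute; sum-cong-≗; sum-replicate-zero)
open import Data.Fin using (Fin; zero; suc; toℕ; fromℕ<; combine; quotient; remainder; funToFin; finToFun)
open import Data.Fin.Properties
  using (toℕ-fromℕ<; toℕ-injective; toℕ<n; toℕ-combine; combine-remQuot; remQuot-combine; funToFin-finToFin; finToFun-funToFin)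
  renaming (_≟_ to _≟ᶠ_)
open import Data.Fin.Permutation using (Permutation; permutation)
open import Data.Fin.Subset using (Subset; _∈_; _∉_; ∣_∣)
open import Data.Vec using ([]; _∷_; _++_; concat; tabulate; lookup)
open import Data.Vec.Properties using (lookup∘tabulate; lookup-concat; []=⇒lookup; lookup⇒[]=)
open import Data.List using ([]; _∷_; length; foldl; _∷ʳ_)
open import Data.List.Properties using (foldl-∷ʳ; length-++)
open import Data.List.Relation.Unary.All using (All; []; _∷_)
open import Data.List.Relation.Unary.All.Properties using (∷ʳ⁺)
open import Data.Product using (Σ; _×_; _,_; proj₁; proj₂)
open import Data.Sum using (_⊎_; inj₁; inj₂)
open import Function using (_∘_; Equivalence)
open import Relation.Binary.Core using (Rel)
open import Relation.Binary.Definitions using (DecidableEquality)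
open import Relation.Binary.PropositionalEquality
  using (_≡_; refl; sym; trans; cong; cong₂; subst; _≗_; isEquivalence; module ≡-Reasoning)
open import Relation.Nullary using (yes; no; ¬_; does; contradiction)

≡-group : {G : Set} {_∙_ : Op₂ G} {ε : G} {_⁻¹ : Op₁ G} → IsGroup _≡_ _∙_ ε _⁻¹ → Group 0ℓ 0ℓ
≡-group {G} {_∙_} {ε} {_⁻¹} isGroup = record
  { Carrier = G ; _≈_ = _≡_ ; _∙_ = _∙_ ; ε = ε ; _⁻¹ = _⁻¹ ; isGroup = isGroup }

module _ (G : FinGroup) (S : Subset (order G)) where

  open FinGroup G using () renaming (_∙_ to _·_; ε to e; _⁻¹ to _⁻¹ᴳ)
  open IsGroup (isGroup G) using (assoc; identityʳ)
  open GroupProperties (≡-group (isGroup G)) using (\\-leftDividesˡ)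

  foldl-·ˡ : ∀ a b ss → foldl _·_ (a · b) ss ≡ a · foldl _·_ b ss
  foldl-·ˡ a b []       = refl
  foldl-·ˡ a b (s ∷ ss) = trans (cong (λ c → foldl _·_ c ss) (assoc a b s)) (foldl-·ˡ a (b · s) ss)

  distAtMost-translate : ∀ {d} g h → DistAtMost G S d e ((g ⁻¹ᴳ) · h) → DistAtMost G S d g h
  distAtMost-translate g h (n , n≤d , ss , len , ss∈S , ss≡) = n , n≤d , ss , len , ss∈S , (begin
    foldl _·_ g ss               ≡⟨ cong (λ c → foldl _·_ c ss) (identityʳ g) ⟨
    foldl _·_ (g · e) ss         ≡⟨ foldl-·ˡ g e ss ⟩
    g · foldl _·_ e ss           ≡⟨ cong (g ·_) ss≡ ⟩
    g · ((g ⁻¹ᴳ) · h)            ≡⟨ \\-leftDividesˡ g h ⟩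
    h                            ∎)
    where open ≡-Reasoning

  data LazyWalk (g : Fin (order G)) : ℕ → Fin (order G) → Set where
    []   : LazyWalk g 0 g
    step : ∀ {n h h′ s} → LazyWalk g n h → s ≡ e ⊎ s ∈ S → h · s ≡ h′ → LazyWalk g (suc n) h′

  lazyWalk⇒distAtMost : ∀ {g n h} → LazyWalk g n h → DistAtMost G S n g h
  lazyWalk⇒distAtMost [] = 0 , z≤n , [] , refl , [] , refl
  lazyWalk⇒distAtMost (step {h = h} w (inj₁ refl) h·e≡h′) with lazyWalk⇒distAtMost w
  ... | d , d≤n , walk = d , m≤n⇒m≤1+n d≤n , subst (WalkOfLength G S d _) (trans (sym (identityʳ h)) h·e≡h′) walk
  lazyWalk⇒distAtMost {g} (step {s = s} w (inj₂ s∈S) h·s≡h′) with lazyWalk⇒distAtMost w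
  ... | d , d≤n , ss , len , ss∈S , ss≡ =
    suc d , s≤s d≤n , ss ∷ʳ s ,
    trans (length-++ ss) (trans (+-comm (length ss) 1) (cong suc len)) ,
    ∷ʳ⁺ ss∈S s∈S ,
    trans (foldl-∷ʳ _·_ g s ss) (trans (cong (_· s) ss≡) h·s≡h′)

  walk-potential : (w : Fin (order G) → ℕ) (L : ℕ) → (∀ g s → s ∈ S → w (g · s) ≤ w g + L) →
                   ∀ {n g h} → WalkOfLength G S n g h → w h ≤ w g + n * L
  walk-potential w L w-step (ss , refl , ss∈S , refl) = go ss ss∈S
    where
    go : ∀ {g} ss → All (_∈ S) ss → w (foldl _·_ g ss) ≤ w g + length ss * L
    go {g} []       []           = m≤m+n (w g) 0
    go {g} (s ∷ ss) (s∈S ∷ ss∈S) = begin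
      w (foldl _·_ (g · s) ss)        ≤⟨ go ss ss∈S ⟩
      w (g · s) + length ss * L       ≤⟨ +-monoˡ-≤ _ (w-step g s s∈S) ⟩
      w g + L + length ss * L         ≡⟨ +-assoc (w g) L _ ⟩
      w g + (L + length ss * L)       ∎
      where open ≤-Reasoning

module Cyclic (n-1 : ℕ) where

  n : ℕ
  n = suc n-1

  _⊕_ : Op₂ (Fin n)
  a ⊕ b = fromℕ< (m%n<n (toℕ a + toℕ b) n)

  ⊖_ : Op₁ (Fin n)
  ⊖ a = fromℕ< (m%n<n (n ∸ toℕ a) n)

  toℕ-⊕ : ∀ a b → toℕ (a ⊕ b) ≡ (toℕ a + toℕ b) % n
  toℕ-⊕ a b = toℕ-fromℕ< (m%n<n (toℕ a + toℕ b) n)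

  toℕ-⊖ : ∀ a → toℕ (⊖ a) ≡ (n ∸ toℕ a) % n
  toℕ-⊖ a = toℕ-fromℕ< (m%n<n (n ∸ toℕ a) n)

  [m%n+o]%n≡[m+o]%n : ∀ m o → (m % n + o) % n ≡ (m + o) % n
  [m%n+o]%n≡[m+o]%n m o = begin
    (m % n + o) % n         ≡⟨ %-distribˡ-+ (m % n) o n ⟩
    (m % n % n + o % n) % n ≡⟨ cong (λ k → (k + o % n) % n) (m%n%n≡m%n m n) ⟩
    (m % n + o % n) % n     ≡⟨ %-distribˡ-+ m o n ⟨
    (m + o) % n             ∎
    where open ≡-Reasoning

  [m+o%n]%n≡[m+o]%n : ∀ m o → (m + o % n) % n ≡ (m + o) % n
  [m+o%n]%n≡[m+o]%n m o = begin
    (m + o % n) % n ≡⟨ cong (_% n) (+-comm m (o % n)) ⟩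
    (o % n + m) % n ≡⟨ [m%n+o]%n≡[m+o]%n o m ⟩
    (o + m) % n     ≡⟨ cong (_% n) (+-comm o m) ⟩
    (m + o) % n     ∎
    where open ≡-Reasoning

  ⊕-assoc : ∀ a b c → (a ⊕ b) ⊕ c ≡ a ⊕ (b ⊕ c)
  ⊕-assoc a b c = toℕ-injective (begin
    toℕ ((a ⊕ b) ⊕ c)                  ≡⟨ toℕ-⊕ (a ⊕ b) c ⟩
    (toℕ (a ⊕ b) + toℕ c) % n          ≡⟨ cong (λ k → (k + toℕ c) % n) (toℕ-⊕ a b) ⟩
    ((toℕ a + toℕ b) % n + toℕ c) % n  ≡⟨ [m%n+o]%n≡[m+o]%n (toℕ a + toℕ b) (toℕ c) ⟩
    (toℕ a + toℕ b + toℕ c) % n        ≡⟨ cong (_% n) (+-assoc (toℕ a) (toℕ b) (toℕ c)) ⟩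
    (toℕ a + (toℕ b + toℕ c)) % n      ≡⟨ [m+o%n]%n≡[m+o]%n (toℕ a) (toℕ b + toℕ c) ⟨
    (toℕ a + (toℕ b + toℕ c) % n) % n  ≡⟨ cong (λ k → (toℕ a + k) % n) (toℕ-⊕ b c) ⟨
    (toℕ a + toℕ (b ⊕ c)) % n          ≡⟨ toℕ-⊕ a (b ⊕ c) ⟨
    toℕ (a ⊕ (b ⊕ c))                  ∎)
    where open ≡-Reasoning

  ⊕-identityˡ : ∀ a → zero ⊕ a ≡ a
  ⊕-identityˡ a = toℕ-injective (trans (toℕ-⊕ zero a) (m<n⇒m%n≡m (toℕ<n a)))

  ⊕-identityʳ : ∀ a → a ⊕ zero ≡ a
  ⊕-identityʳ a = toℕ-injective (begin
    toℕ (a ⊕ zero)    ≡⟨ toℕ-⊕ a zero ⟩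
    (toℕ a + 0) % n   ≡⟨ cong (_% n) (+-identityʳ (toℕ a)) ⟩
    toℕ a % n         ≡⟨ m<n⇒m%n≡m (toℕ<n a) ⟩
    toℕ a             ∎)
    where open ≡-Reasoning

  ⊖-inverseˡ : ∀ a → (⊖ a) ⊕ a ≡ zero
  ⊖-inverseˡ a = toℕ-injective (begin
    toℕ ((⊖ a) ⊕ a)                 ≡⟨ toℕ-⊕ (⊖ a) a ⟩
    (toℕ (⊖ a) + toℕ a) % n         ≡⟨ cong (λ k → (k + toℕ a) % n) (toℕ-⊖ a) ⟩
    ((n ∸ toℕ a) % n + toℕ a) % n   ≡⟨ [m%n+o]%n≡[m+o]%n (n ∸ toℕ a) (toℕ a) ⟩
    (n ∸ toℕ a + toℕ a) % n         ≡⟨ cong (_% n) (m∸n+n≡m (<⇒≤ (toℕ<n a))) ⟩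
    n % n                           ≡⟨ n%n≡0 n ⟩
    0                               ∎)
    where open ≡-Reasoning

  ⊖-inverseʳ : ∀ a → a ⊕ (⊖ a) ≡ zero
  ⊖-inverseʳ a = toℕ-injective (begin
    toℕ (a ⊕ (⊖ a))                 ≡⟨ toℕ-⊕ a (⊖ a) ⟩
    (toℕ a + toℕ (⊖ a)) % n         ≡⟨ cong (λ k → (toℕ a + k) % n) (toℕ-⊖ a) ⟩
    (toℕ a + (n ∸ toℕ a) % n) % n   ≡⟨ [m+o%n]%n≡[m+o]%n (toℕ a) (n ∸ toℕ a) ⟩
    (toℕ a + (n ∸ toℕ a)) % n       ≡⟨ cong (_% n) (m+[n∸m]≡n (<⇒≤ (toℕ<n a))) ⟩
    n % n                           ≡⟨ n%n≡0 n ⟩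
    0                               ∎)
    where open ≡-Reasoning

  ⊕-isGroup : IsGroup _≡_ _⊕_ zero ⊖_
  ⊕-isGroup = record
    { isMonoid = record
      { isSemigroup = record
        { isMagma = record { isEquivalence = isEquivalence ; ∙-cong = cong₂ _⊕_ }
        ; assoc = ⊕-assoc }
      ; identity = ⊕-identityˡ , ⊕-identityʳ }
    ; inverse = ⊖-inverseˡ , ⊖-inverseʳ
    ; ⁻¹-cong = cong ⊖_ }

  toℕ-⊕-< : ∀ a b → toℕ a + toℕ b < n → toℕ (a ⊕ b) ≡ toℕ a + toℕ b
  toℕ-⊕-< a b a+b<n = trans (toℕ-⊕ a b) (m<n⇒m%n≡m a+b<n)

  toℕ-⊕-≥ : ∀ a b → n ≤ toℕ a + toℕ b → toℕ (a ⊕ b) + n ≡ toℕ a + toℕ b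
  toℕ-⊕-≥ a b n≤a+b = begin
    toℕ (a ⊕ b) + n                ≡⟨ cong (_+ n) (toℕ-⊕ a b) ⟩
    (toℕ a + toℕ b) % n + n        ≡⟨ cong (λ k → k % n + n) (m∸n+n≡m n≤a+b) ⟨
    (toℕ a + toℕ b ∸ n + n) % n + n ≡⟨ cong (_+ n) ([m+n]%n≡m%n (toℕ a + toℕ b ∸ n) n) ⟩
    (toℕ a + toℕ b ∸ n) % n + n    ≡⟨ cong (_+ n) (m<n⇒m%n≡m a+b∸n<n) ⟩
    toℕ a + toℕ b ∸ n + n          ≡⟨ m∸n+n≡m n≤a+b ⟩
    toℕ a + toℕ b                  ∎
    where
    open ≡-Reasoning
    a+b∸n<n : toℕ a + toℕ b ∸ n < n
    a+b∸n<n = +-cancelʳ-< n _ n (subst (_< n + n) (sym (m∸n+n≡m n≤a+b)) (+-mono-< (toℕ<n a) (toℕ<n b)))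

  toℕ-⊕-wrap-< : ∀ a b w → n ≤ toℕ a + toℕ b → toℕ b + w ≤ n → toℕ (a ⊕ b) + w < n
  toℕ-⊕-wrap-< a b w n≤a+b b+w≤n = +-cancelʳ-< n _ n (begin-strict
    toℕ (a ⊕ b) + w + n   ≡⟨ +-assoc (toℕ (a ⊕ b)) w n ⟩
    toℕ (a ⊕ b) + (w + n) ≡⟨ cong (toℕ (a ⊕ b) +_) (+-comm w n) ⟩
    toℕ (a ⊕ b) + (n + w) ≡⟨ +-assoc (toℕ (a ⊕ b)) n w ⟨
    toℕ (a ⊕ b) + n + w   ≡⟨ cong (_+ w) (toℕ-⊕-≥ a b n≤a+b) ⟩
    toℕ a + toℕ b + w     ≡⟨ +-assoc (toℕ a) (toℕ b) w ⟩
    toℕ a + (toℕ b + w)   <⟨ +-mono-<-≤ (toℕ<n a) b+w≤n ⟩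
    n + n                 ∎)
    where open ≤-Reasoning

module GroupOnEncoding
  {A B : Set} {_≈_ : Rel A 0ℓ} {_∙_ : Op₂ A} {ε : A} {_⁻¹ : Op₁ A}
  (isGroup : IsGroup _≈_ _∙_ ε _⁻¹)
  (code : A → B) (decode : B → A)
  (code-cong : ∀ {x y} → x ≈ y → code x ≡ code y)
  (code-decode : ∀ b → code (decode b) ≡ b)
  (decode-code : ∀ x → decode (code x) ≈ x)
  where

  open IsGroup isGroup using (∙-cong) renaming (refl to ≈-refl)

  _·_ : Op₂ B
  a · b = code (decode a ∙ decode b)

  1ᴮ : B
  1ᴮ = code ε

  _⁻¹ᴮ : Op₁ B
  a ⁻¹ᴮ = code (decode a ⁻¹)

  code-homo : ∀ x y → code x · code y ≡ code (x ∙ y)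
  code-homo x y = code-cong (∙-cong (decode-code x) (decode-code y))

  decode-isGroupMonomorphism : IsGroupMonomorphism
    (record { Carrier = B ; _≈_ = _≡_ ; _∙_ = _·_ ; ε = 1ᴮ ; _⁻¹ = _⁻¹ᴮ })
    (record { Carrier = A ; _≈_ = _≈_ ; _∙_ = _∙_ ; ε = ε ; _⁻¹ = _⁻¹ })
    decode
  decode-isGroupMonomorphism = record
    { isGroupHomomorphism = record
      { isMonoidHomomorphism = record
        { isMagmaHomomorphism = record
          { isRelHomomorphism = record { cong = λ { refl → ≈-refl } }
          ; homo = λ a b → decode-code (decode a ∙ decode b) }
        ; ε-homo = decode-code ε }
      ; ⁻¹-homo = λ a → decode-code (decode a ⁻¹) }
    ; injective = λ {a} {b} da≈db → trans (sym (code-decode a)) (trans (code-cong da≈db) (code-decode b)) }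

  ·-isGroup : IsGroup _≡_ _·_ 1ᴮ _⁻¹ᴮ
  ·-isGroup = GroupMonomorphism.isGroup decode-isGroupMonomorphism isGroup

SupportedInLast : ∀ {A : Set} {n} → A → ℕ → (Fin n → A) → Set
SupportedInLast {n = n} o w x = ∀ c → toℕ c + w < n → x c ≡ o

sum-mono-≤ : ∀ {n} {f g : Fin n → ℕ} → (∀ c → f c ≤ g c) → sum f ≤ sum g
sum-mono-≤ {zero}  f≤g = z≤n
sum-mono-≤ {suc n} f≤g = +-mono-≤ (f≤g zero) (sum-mono-≤ (f≤g ∘ suc))

-- The regular wreath product A ≀ H, with H acting on its carrier Fin r by right translation.
module Wreath
  {A : Set} {_◇_ : Op₂ A} {𝟙 : A} {_⁻¹ᴬ : Op₁ A} (A-isGroup : IsGroup _≡_ _◇_ 𝟙 _⁻¹ᴬ)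
  {r : ℕ} {_⊕_ : Op₂ (Fin r)} {𝟘 : Fin r} {⊖_ : Op₁ (Fin r)} (H-isGroup : IsGroup _≡_ _⊕_ 𝟘 ⊖_)
  where

  private
    module A = IsGroup A-isGroup
    module H = IsGroup H-isGroup
  open GroupProperties (≡-group H-isGroup) using (//-rightDividesˡ; //-rightDividesʳ)

  W : Set
  W = Fin r × (Fin r → A)

  record _≈_ (p q : W) : Set where
    constructor _,_
    field
      proj₁-≡ : proj₁ p ≡ proj₁ q
      proj₂-≗ : proj₂ p ≗ proj₂ q

  _⋆_ : Op₂ W
  (i , x) ⋆ (j , y) = i ⊕ j , λ c → x c ◇ y (c ⊕ i)

  1ʷ : W
  1ʷ = 𝟘 , λ _ → 𝟙

  _⁻¹ʷ : Op₁ W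
  (i , x) ⁻¹ʷ = ⊖ i , λ c → x (c ⊕ (⊖ i)) ⁻¹ᴬ

  ⋆-assoc : ∀ p q s → ((p ⋆ q) ⋆ s) ≈ (p ⋆ (q ⋆ s))
  ⋆-assoc (i , x) (j , y) (k , z) = H.assoc i j k , λ c →
    trans (A.assoc _ _ _) (cong (λ d → x c ◇ (y (c ⊕ i) ◇ z d)) (sym (H.assoc c i j)))

  ⋆-identityˡ : ∀ p → (1ʷ ⋆ p) ≈ p
  ⋆-identityˡ (j , y) = H.identityˡ j , λ c → trans (A.identityˡ _) (cong y (H.identityʳ c))

  ⋆-identityʳ : ∀ p → (p ⋆ 1ʷ) ≈ p
  ⋆-identityʳ (i , x) = H.identityʳ i , λ c → A.identityʳ (x c)

  ⋆-inverseˡ : ∀ p → ((p ⁻¹ʷ) ⋆ p) ≈ 1ʷ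
  ⋆-inverseˡ (i , x) = H.inverseˡ i , λ c → A.inverseˡ (x (c ⊕ (⊖ i)))

  ⋆-inverseʳ : ∀ p → (p ⋆ (p ⁻¹ʷ)) ≈ 1ʷ
  ⋆-inverseʳ (i , x) = H.inverseʳ i , λ c →
    trans (cong (λ d → x c ◇ (x d ⁻¹ᴬ)) (//-rightDividesʳ i c)) (A.inverseʳ (x c))

  ⋆-cong : ∀ {p p′ q q′} → p ≈ p′ → q ≈ q′ → (p ⋆ q) ≈ (p′ ⋆ q′)
  ⋆-cong {i , _} (refl , x≗x′) (refl , y≗y′) = refl , λ c → cong₂ _◇_ (x≗x′ c) (y≗y′ (c ⊕ i))

  ⁻¹ʷ-cong : ∀ {p q} → p ≈ q → (p ⁻¹ʷ) ≈ (q ⁻¹ʷ)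
  ⁻¹ʷ-cong {i , _} (refl , x≗y) = refl , λ c → cong _⁻¹ᴬ (x≗y (c ⊕ (⊖ i)))

  ⋆-isGroup : IsGroup _≈_ _⋆_ 1ʷ _⁻¹ʷ
  ⋆-isGroup = record
    { isMonoid = record
      { isSemigroup = record
        { isMagma = record
          { isEquivalence = record
            { refl  = refl , λ _ → refl
            ; sym   = λ (i≡j , x≗y) → sym i≡j , λ c → sym (x≗y c)
            ; trans = λ (i≡j , x≗y) (j≡k , y≗z) → trans i≡j j≡k , λ c → trans (x≗y c) (y≗z c) }
          ; ∙-cong = ⋆-cong }
        ; assoc = ⋆-assoc }
      ; identity = ⋆-identityˡ , ⋆-identityʳ }
    ; inverse = ⋆-inverseˡ , ⋆-inverseʳ
    ; ⁻¹-cong = ⁻¹ʷ-cong }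

  module Weight (_≟ᴬ_ : DecidableEquality A) where

    nonUnit : A → ℕ
    nonUnit a with a ≟ᴬ 𝟙
    ... | yes _ = 0
    ... | no  _ = 1

    weight : ∀ {n} → (Fin n → A) → ℕ
    weight x = sum (nonUnit ∘ x)

    nonUnit-𝟙 : nonUnit 𝟙 ≡ 0
    nonUnit-𝟙 with 𝟙 ≟ᴬ 𝟙
    ... | yes _   = refl
    ... | no 𝟙≢𝟙 = contradiction refl 𝟙≢𝟙

    nonUnit-≢𝟙 : ∀ {a} → ¬ a ≡ 𝟙 → nonUnit a ≡ 1
    nonUnit-≢𝟙 {a} a≢𝟙 with a ≟ᴬ 𝟙
    ... | yes a≡𝟙 = contradiction a≡𝟙 a≢𝟙
    ... | no  _   = refl

    nonUnit-≤ : ∀ a → nonUnit a ≤ 1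
    nonUnit-≤ a with a ≟ᴬ 𝟙
    ... | yes _ = z≤n
    ... | no  _ = ≤-refl

    nonUnit-◇ : ∀ a b → nonUnit (a ◇ b) ≤ nonUnit a + nonUnit b
    nonUnit-◇ a b with a ≟ᴬ 𝟙
    ... | yes refl = ≤-reflexive (cong nonUnit (A.identityˡ b))
    ... | no  _    = ≤-trans (nonUnit-≤ (a ◇ b)) (m≤m+n 1 (nonUnit b))

    weight-cong : ∀ {n} {x y : Fin n → A} → x ≗ y → weight x ≡ weight y
    weight-cong x≗y = sum-cong-≗ (cong nonUnit ∘ x≗y)

    weight-≤ : ∀ {n} (x : Fin n → A) → weight x ≤ n
    weight-≤ {zero}  x = z≤n
    weight-≤ {suc n} x = +-mono-≤ (nonUnit-≤ (x zero)) (weight-≤ (x ∘ suc))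

    weight-𝟙 : ∀ {n} → weight {n} (λ _ → 𝟙) ≡ 0
    weight-𝟙 {zero}  = refl
    weight-𝟙 {suc n} = cong₂ _+_ nonUnit-𝟙 (weight-𝟙 {n})

    weight-≢𝟙 : ∀ {n} (x : Fin n → A) → (∀ c → ¬ x c ≡ 𝟙) → weight x ≡ n
    weight-≢𝟙 {zero}  x _    = refl
    weight-≢𝟙 {suc n} x x≢𝟙 = cong₂ _+_ (nonUnit-≢𝟙 (x≢𝟙 zero)) (weight-≢𝟙 (x ∘ suc) (x≢𝟙 ∘ suc))

    weight-◇ : ∀ {n} (x y : Fin n → A) → weight (λ c → x c ◇ y c) ≤ weight x + weight y
    weight-◇ x y = ≤-trans (sum-mono-≤ (λ c → nonUnit-◇ (x c) (y c)))
                           (≤-reflexive (∑-distrib-+ (nonUnit ∘ x) (nonUnit ∘ y)))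

    weight-supportedInLast : ∀ {n w} (x : Fin n → A) → SupportedInLast 𝟙 w x → weight x ≤ w
    weight-supportedInLast {zero}      x _    = z≤n
    weight-supportedInLast {suc n} {w} x supp with w ≤? n
    ... | no  w≰n = ≤-trans (weight-≤ x) (≰⇒> w≰n)
    ... | yes w≤n = begin
      nonUnit (x zero) + weight (x ∘ suc) ≡⟨ cong (λ a → nonUnit a + weight (x ∘ suc)) (supp zero (s≤s w≤n)) ⟩
      nonUnit 𝟙 + weight (x ∘ suc)        ≡⟨ cong (_+ weight (x ∘ suc)) nonUnit-𝟙 ⟩
      weight (x ∘ suc)                    ≤⟨ weight-supportedInLast (x ∘ suc) (λ c → supp (suc c) ∘ s≤s) ⟩
      w                                   ∎
      where open ≤-Reasoning

    translation : Fin r → Permutation r r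
    translation i = permutation (_⊕ i) (_⊕ (⊖ i)) (//-rightDividesˡ i) (//-rightDividesʳ i)

    weight-translate : ∀ (y : Fin r → A) i → weight (λ c → y (c ⊕ i)) ≡ weight y
    weight-translate y i = sym (sum-permute (nonUnit ∘ y) (translation i))

    weight-⋆ : ∀ p q → weight (proj₂ (p ⋆ q)) ≤ weight (proj₂ p) + weight (proj₂ q)
    weight-⋆ (i , x) (j , y) = begin
      weight (λ c → x c ◇ y (c ⊕ i))        ≤⟨ weight-◇ x (λ c → y (c ⊕ i)) ⟩
      weight x + weight (λ c → y (c ⊕ i))   ≡⟨ cong (weight x +_) (weight-translate y i) ⟩
      weight x + weight y                   ∎
      where open ≤-Reasoning

m*n+o<m⇒n≡0 : ∀ m n o → m * n + o < m → n ≡ 0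
m*n+o<m⇒n≡0 m zero    o _      = refl
m*n+o<m⇒n≡0 m (suc n) o m*n+o<m =
  contradiction m*n+o<m (≤⇒≯ (≤-trans (m≤m*n m (suc n)) (m≤m+n (m * suc n) o)))

toℕ-quotient-remainder : ∀ {m} k (a : Fin (m * k)) → toℕ a ≡ k * toℕ (quotient {m} k a) + toℕ (remainder {m} k a)
toℕ-quotient-remainder {m} k a =
  trans (cong toℕ (sym (combine-remQuot {m} k a))) (toℕ-combine (quotient {m} k a) (remainder {m} k a))

funToFin-cong : ∀ {m n} {x y : Fin m → Fin n} → x ≗ y → funToFin x ≡ funToFin y
funToFin-cong {zero}  _    = refl
funToFin-cong {suc m} x≗y = cong₂ combine (x≗y zero) (funToFin-cong (x≗y ∘ suc))

-- funToFin reads x as a numeral in base t with most significant digit x zero,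
-- so it is small exactly when x vanishes outside its last coordinates.
funToFin-< : ∀ {t n w} (x : Fin n → Fin (suc t)) → w ≤ n → SupportedInLast zero w x →
             toℕ (funToFin x) < suc t ^ w
funToFin-< {n = zero}  x z≤n _ = s≤s z≤n
funToFin-< {t} {suc n} {w} x w≤1+n supp with m≤n⇒m<n∨m≡n w≤1+n
... | inj₂ refl  = toℕ<n (funToFin x)
... | inj₁ w<1+n = begin-strict
  toℕ (funToFin x)                                   ≡⟨ toℕ-combine (x zero) (funToFin (x ∘ suc)) ⟩
  suc t ^ n * toℕ (x zero) + toℕ (funToFin (x ∘ suc))
    ≡⟨ cong (λ d → suc t ^ n * toℕ d + toℕ (funToFin (x ∘ suc))) (supp zero w<1+n) ⟩
  suc t ^ n * 0 + toℕ (funToFin (x ∘ suc))           ≡⟨ cong (_+ toℕ (funToFin (x ∘ suc))) (*-zeroʳ (suc t ^ n)) ⟩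
  toℕ (funToFin (x ∘ suc))                           <⟨ funToFin-< (x ∘ suc) (≤-pred w<1+n) (λ c → supp (suc c) ∘ s≤s) ⟩
  suc t ^ w                                          ∎
  where open ≤-Reasoning

finToFun-supportedInLast : ∀ {t n w} (a : Fin (suc t ^ n)) → toℕ a < suc t ^ w →
                           SupportedInLast zero w (finToFun {suc t} {n} a)
finToFun-supportedInLast {t} {suc n} {w} a a<tʷ zero w<1+n =
  toℕ-injective (m*n+o<m⇒n≡0 (suc t ^ n) _ (toℕ (remainder {suc t} (suc t ^ n) a)) (begin-strict
    suc t ^ n * toℕ (quotient {suc t} (suc t ^ n) a) + toℕ (remainder {suc t} (suc t ^ n) a)
                 ≡⟨ toℕ-quotient-remainder {suc t} (suc t ^ n) a ⟨
    toℕ a        <⟨ a<tʷ ⟩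
    suc t ^ w    ≤⟨ ^-monoʳ-≤ (suc t) (≤-pred w<1+n) ⟩
    suc t ^ n    ∎))
  where open ≤-Reasoning
finToFun-supportedInLast {t} {suc n} {w} a a<tʷ (suc c) (s≤s c+w<n) =
  finToFun-supportedInLast (remainder {suc t} (suc t ^ n) a) remainder<tʷ c c+w<n
  where
  remainder<tʷ : toℕ (remainder {suc t} (suc t ^ n) a) < suc t ^ w
  remainder<tʷ = ≤-<-trans (≤-trans (m≤n+m _ _) (≤-reflexive (sym (toℕ-quotient-remainder {suc t} (suc t ^ n) a)))) a<tʷ

-- The upper bound is tested first so that ∣interval∣ holds clause by clause by computation.
interval : ∀ {n} → ℕ → ℕ → Subset n
interval a b = tabulate (λ j → (toℕ j <ᵇ b) ∧ (a ≤ᵇ toℕ j))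

∣interval∣ : ∀ {n} a b → ∣ interval {n} a b ∣ ≡ b ⊓ n ∸ a
∣interval∣ {zero}  a             zero    = sym (0∸n≡0 a)
∣interval∣ {zero}  a             (suc b) = sym (0∸n≡0 a)
∣interval∣ {suc n} a             zero    = ∣interval∣ {n} a zero
∣interval∣ {suc n} zero          (suc b) = cong suc (∣interval∣ {n} zero b)
∣interval∣ {suc n} (suc zero)    (suc b) = ∣interval∣ {n} zero b
∣interval∣ {suc n} (suc (suc a)) (suc b) = ∣interval∣ {n} (suc a) b

∈-interval⁻ : ∀ {n} a b {j : Fin n} → j ∈ interval a b → a ≤ toℕ j × toℕ j < b
∈-interval⁻ a b {j} j∈ab =
  let j<b , a≤j = Equivalence.to T-∧ (Equivalence.from T-≡ (trans (sym (lookup∘tabulate _ j)) ([]=⇒lookup j∈ab)))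
  in ≤ᵇ⇒≤ a (toℕ j) a≤j , <ᵇ⇒< (toℕ j) b j<b

∈-interval⁺ : ∀ {n} a b {j : Fin n} → a ≤ toℕ j → toℕ j < b → j ∈ interval a b
∈-interval⁺ a b {j} a≤j j<b = lookup⇒[]= j _
  (trans (lookup∘tabulate _ j) (Equivalence.to T-≡ (Equivalence.from T-∧ (<⇒<ᵇ j<b , ≤⇒≤ᵇ a≤j))))

∣p++q∣ : ∀ {m n} (p : Subset m) (q : Subset n) → ∣ p ++ q ∣ ≡ ∣ p ∣ + ∣ q ∣
∣p++q∣ []          q = refl
∣p++q∣ (true ∷ p)  q = cong suc (∣p++q∣ p q)
∣p++q∣ (false ∷ p) q = ∣p++q∣ p q

∣concat-tabulate∣ : ∀ {m n} (ps : Fin m → Subset n) → ∣ concat (tabulate ps) ∣ ≡ sum (∣_∣ ∘ ps)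
∣concat-tabulate∣ {zero}  ps = refl
∣concat-tabulate∣ {suc m} ps = trans (∣p++q∣ (ps zero) _) (cong (∣ ps zero ∣ +_) (∣concat-tabulate∣ (ps ∘ suc)))

sum-const : ∀ n c → sum {n} (λ _ → c) ≡ n * c
sum-const zero    c = refl
sum-const (suc n) c = cong (c +_) (sum-const n c)

sum-δ : ∀ {n} (a : Fin n) c → sum (λ i → if does (i ≟ᶠ a) then c else 0) ≡ c
sum-δ {suc n} zero    c = trans (cong (c +_) (sum-replicate-zero n)) (+-identityʳ c)
sum-δ {suc n} (suc a) c = sum-δ a c

module CyclicWreath (r-1 t-1 : ℕ) where

  r t : ℕ
  r = suc r-1
  t = suc t-1

  module ℤᵣ = Cyclic r-1
  module ℤₜ = Cyclic t-1
  open ℤᵣ using (_⊕_; ⊖_; toℕ-⊕-<; toℕ-⊕-wrap-<)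
  open GroupProperties (≡-group ℤᵣ.⊕-isGroup) using (//-rightDividesʳ)
  open Wreath ℤₜ.⊕-isGroup ℤᵣ.⊕-isGroup public
  open Weight _≟ᶠ_ public

  code : W → Fin (r * t ^ r)
  code (i , x) = combine i (funToFin x)

  decode : Fin (r * t ^ r) → W
  decode a = quotient {r} (t ^ r) a , finToFun (remainder {r} (t ^ r) a)

  code-cong : ∀ {p q} → p ≈ q → code p ≡ code q
  code-cong {i , _} (refl , x≗y) = cong (combine i) (funToFin-cong x≗y)

  code-decode : ∀ a → code (decode a) ≡ a
  code-decode a = trans (cong (combine (quotient {r} (t ^ r) a)) (funToFin-finToFin {r} {t} (remainder {r} (t ^ r) a)))
                        (combine-remQuot {r} (t ^ r) a)

  decode-code : ∀ p → decode (code p) ≈ p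
  decode-code (i , x) = cong proj₁ remQuot≡ , λ c →
    trans (cong (λ ij → finToFun (proj₂ ij) c) remQuot≡) (finToFun-funToFin x c)
    where remQuot≡ = remQuot-combine {r} {t ^ r} i (funToFin x)

  open GroupOnEncoding ⋆-isGroup code decode code-cong code-decode decode-code public

  group : FinGroup
  group = record { order = r * t ^ r ; _∙_ = _·_ ; ε = 1ᴮ ; _⁻¹ = _⁻¹ᴮ ; isGroup = ·-isGroup }

  weightᴳ : Fin (r * t ^ r) → ℕ
  weightᴳ = weight ∘ proj₂ ∘ decode

  weightᴳ-code : ∀ p → weightᴳ (code p) ≡ weight (proj₂ p)
  weightᴳ-code p = weight-cong (_≈_.proj₂-≗ (decode-code p))

  weightᴳ-· : ∀ a b → weightᴳ (a · b) ≤ weightᴳ a + weightᴳ b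
  weightᴳ-· a b = ≤-trans (≤-reflexive (weightᴳ-code (decode a ⋆ decode b))) (weight-⋆ (decode a) (decode b))

  suffix : ℕ → (Fin r → Fin t) → Fin r → Fin t
  suffix b x c with r ≤? toℕ c + b
  ... | yes _ = x c
  ... | no  _ = zero

  suffix-inside : ∀ b x c → r ≤ toℕ c + b → suffix b x c ≡ x c
  suffix-inside b x c r≤c+b with r ≤? toℕ c + b
  ... | yes _   = refl
  ... | no r≰c+b = contradiction r≤c+b r≰c+b

  suffix-outside : ∀ b x c → toℕ c + b < r → suffix b x c ≡ zero
  suffix-outside b x c c+b<r with r ≤? toℕ c + b
  ... | yes r≤c+b = contradiction c+b<r (≤⇒≯ r≤c+b)
  ... | no  _     = refl

  suffix-supportedInLast : ∀ b x → SupportedInLast zero b (suffix b x)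
  suffix-supportedInLast b x c = suffix-outside b x c

  suffix-zero : ∀ x → suffix 0 x ≗ λ _ → zero
  suffix-zero x c = suffix-outside 0 x c (subst (_< r) (sym (+-identityʳ (toℕ c))) (toℕ<n c))

  suffix-full : ∀ {b} → r ≤ b → ∀ x → suffix b x ≗ x
  suffix-full {b} r≤b x c = suffix-inside b x c (≤-trans r≤b (m≤n+m _ (toℕ c)))

  suffix-reindex : ∀ b b′ x y c d → toℕ d + b ≡ toℕ c + b′ → y d ≡ x c → suffix b y d ≡ suffix b′ x c
  suffix-reindex b b′ x y c d d+b≡c+b′ yd≡xc with ≤-<-connex r (toℕ c + b′)
  ... | inj₁ r≤ = begin
    suffix b y d   ≡⟨ suffix-inside b y d (subst (r ≤_) (sym d+b≡c+b′) r≤) ⟩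
    y d            ≡⟨ yd≡xc ⟩
    x c            ≡⟨ suffix-inside b′ x c r≤ ⟨
    suffix b′ x c  ∎
    where open ≡-Reasoning
  ... | inj₂ c+b′<r = begin
    suffix b y d   ≡⟨ suffix-outside b y d (subst (_< r) (sym d+b≡c+b′) c+b′<r) ⟩
    zero           ≡⟨ suffix-outside b′ x c c+b′<r ⟨
    suffix b′ x c  ∎
    where open ≡-Reasoning

  -- Right multiplication by (j , suffix w (x ∘ (_⊕ ⊖ α))) copies the w coordinates
  -- of x just before the last toℕ α ones into place, as long as nothing wraps around.
  suffix-extend : ∀ α j w x → toℕ α + w ≤ r →
    ((α , suffix (toℕ α) x) ⋆ (j , suffix w (λ d → x (d ⊕ (⊖ α))))) ≈ (α ⊕ j , suffix (toℕ α + w) x)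
  suffix-extend α j w x α+w≤r = refl , extend
    where
    a = toℕ α
    x′ : Fin r → Fin t
    x′ d = x (d ⊕ (⊖ α))
    extend : ∀ c → suffix a x c ℤₜ.⊕ suffix w x′ (c ⊕ α) ≡ suffix (a + w) x c
    extend c with ≤-<-connex r (toℕ c + a)
    ... | inj₁ r≤c+a = begin
      suffix a x c ℤₜ.⊕ suffix w x′ (c ⊕ α) ≡⟨ cong₂ ℤₜ._⊕_ (suffix-inside a x c r≤c+a)
                                                 (suffix-outside w x′ (c ⊕ α) (toℕ-⊕-wrap-< c α w r≤c+a α+w≤r)) ⟩
      x c ℤₜ.⊕ zero                         ≡⟨ ℤₜ.⊕-identityʳ (x c) ⟩
      x c                                   ≡⟨ suffix-inside (a + w) x c r≤c+[a+w] ⟨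
      suffix (a + w) x c                    ∎
      where
      open ≡-Reasoning
      r≤c+[a+w] : r ≤ toℕ c + (a + w)
      r≤c+[a+w] = ≤-trans r≤c+a (≤-trans (m≤m+n (toℕ c + a) w) (≤-reflexive (+-assoc (toℕ c) a w)))
    ... | inj₂ c+a<r = begin
      suffix a x c ℤₜ.⊕ suffix w x′ (c ⊕ α) ≡⟨ cong (ℤₜ._⊕ suffix w x′ (c ⊕ α)) (suffix-outside a x c c+a<r) ⟩
      zero ℤₜ.⊕ suffix w x′ (c ⊕ α)         ≡⟨ ℤₜ.⊕-identityˡ _ ⟩
      suffix w x′ (c ⊕ α)                   ≡⟨ suffix-reindex w (a + w) x x′ c (c ⊕ α) c⊕α+w≡c+[a+w]
                                                                 (cong x (//-rightDividesʳ α c)) ⟩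
      suffix (a + w) x c                    ∎
      where
      open ≡-Reasoning
      c⊕α+w≡c+[a+w] : toℕ (c ⊕ α) + w ≡ toℕ c + (a + w)
      c⊕α+w≡c+[a+w] = trans (cong (_+ w) (toℕ-⊕-< c α c+a<r)) (+-assoc (toℕ c) a w)

module Construction
  (t-2 r-1 q ℓ m : ℕ) (r≡qℓ+m : suc r-1 ≡ q * ℓ + m) (1≤q : 1 ≤ q) (1≤m : 1 ≤ m) (m<ℓ : m < ℓ)
  where

  open CyclicWreath r-1 (suc t-2) public
  open ℤᵣ using (_⊕_; ⊖_; toℕ-⊕-<)
  open GroupProperties (≡-group ℤᵣ.⊕-isGroup) using (\\-leftDividesˡ)

  qℓ<r : q * ℓ < r
  qℓ<r = subst (q * ℓ <_) (sym r≡qℓ+m) (subst (_≤ q * ℓ + m) (+-comm (q * ℓ) 1) (+-monoʳ-≤ (q * ℓ) 1≤m))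

  ℓ<r : ℓ < r
  ℓ<r = ≤-<-trans (subst (_≤ q * ℓ) (*-identityˡ ℓ) (*-monoˡ-≤ ℓ 1≤q)) qℓ<r

  ℓ̂ : Fin r
  ℓ̂ = fromℕ< ℓ<r

  ℓ̂≢0 : ¬ ℓ̂ ≡ zero
  ℓ̂≢0 ℓ̂≡0 = <⇒≢ (≤-<-trans z≤n m<ℓ) (sym (trans (sym (toℕ-fromℕ< ℓ<r)) (cong toℕ ℓ̂≡0)))

  tᵐ≤tˡ : t ^ m ≤ t ^ ℓ
  tᵐ≤tˡ = ^-monoʳ-≤ t (<⇒≤ m<ℓ)

  tˡ≤tʳ : t ^ ℓ ≤ t ^ r
  tˡ≤tʳ = ^-monoʳ-≤ t (<⇒≤ ℓ<r)

  tᵐ≤tʳ : t ^ m ≤ t ^ r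
  tᵐ≤tʳ = ≤-trans tᵐ≤tˡ tˡ≤tʳ

  -- Block i of S holds the codes funToFin y of the y with (i , y) ∈ S, and by funToFin-< and
  -- finToFun-supportedInLast, toℕ (funToFin y) < t ^ w iff y is supported on its last w coordinates.
  generatorBlock : Fin r → Subset (t ^ r)
  generatorBlock i with i ≟ᶠ ℓ̂ | i ≟ᶠ zero
  ... | yes _ | _     = interval 0 (t ^ ℓ)
  ... | no  _ | yes _ = interval 1 (t ^ m)
  ... | no  _ | no  _ = interval 0 (t ^ m)

  S : Subset (r * t ^ r)
  S = concat (tabulate generatorBlock)

  lookup-S : ∀ i j → lookup S (combine i j) ≡ lookup (generatorBlock i) j
  lookup-S i j = trans (lookup-concat (tabulate generatorBlock) i j)
                       (cong (λ p → lookup p j) (lookup∘tabulate generatorBlock i))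

  ∈S⁺ : ∀ i j → j ∈ generatorBlock i → combine i j ∈ S
  ∈S⁺ i j j∈ = lookup⇒[]= (combine i j) S (trans (lookup-S i j) ([]=⇒lookup j∈))

  ∈S⁻ : ∀ i j → combine i j ∈ S → j ∈ generatorBlock i
  ∈S⁻ i j ij∈S = lookup⇒[]= j (generatorBlock i) (trans (sym (lookup-S i j)) ([]=⇒lookup ij∈S))

  ∈generatorBlock-ℓ̂ : ∀ j → toℕ j < t ^ ℓ → j ∈ generatorBlock ℓ̂
  ∈generatorBlock-ℓ̂ j j<tˡ with ℓ̂ ≟ᶠ ℓ̂
  ... | yes _    = ∈-interval⁺ 0 (t ^ ℓ) z≤n j<tˡ
  ... | no ℓ̂≢ℓ̂ = contradiction refl ℓ̂≢ℓ̂

  ∈generatorBlock : ∀ i j → ¬ i ≡ ℓ̂ → toℕ j < t ^ m → (i ≡ zero → 1 ≤ toℕ j) → j ∈ generatorBlock i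
  ∈generatorBlock i j i≢ℓ̂ j<tᵐ 1≤j with i ≟ᶠ ℓ̂ | i ≟ᶠ zero
  ... | yes i≡ℓ̂ | _       = contradiction i≡ℓ̂ i≢ℓ̂
  ... | no _     | yes i≡0 = ∈-interval⁺ 1 (t ^ m) (1≤j i≡0) j<tᵐ
  ... | no _     | no _    = ∈-interval⁺ 0 (t ^ m) z≤n j<tᵐ

  ∈generatorBlock-< : ∀ i j → j ∈ generatorBlock i → toℕ j < t ^ ℓ
  ∈generatorBlock-< i j j∈ with i ≟ᶠ ℓ̂ | i ≟ᶠ zero
  ... | yes _ | _     = proj₂ (∈-interval⁻ 0 (t ^ ℓ) j∈)
  ... | no  _ | yes _ = <-≤-trans (proj₂ (∈-interval⁻ 1 (t ^ m) j∈)) tᵐ≤tˡ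
  ... | no  _ | no  _ = <-≤-trans (proj₂ (∈-interval⁻ 0 (t ^ m) j∈)) tᵐ≤tˡ

  ∈generatorBlock-zero : ∀ j → j ∈ generatorBlock zero → 1 ≤ toℕ j
  ∈generatorBlock-zero j j∈ with zero ≟ᶠ ℓ̂
  ... | yes 0≡ℓ̂ = contradiction (sym 0≡ℓ̂) ℓ̂≢0
  ... | no  _    = proj₁ (∈-interval⁻ 1 (t ^ m) j∈)

  ∣generatorBlock∣ : ∀ i → ∣ generatorBlock i ∣ + (if does (i ≟ᶠ zero) then 1 else 0)
                         ≡ (if does (i ≟ᶠ ℓ̂) then t ^ ℓ ∸ t ^ m else 0) + t ^ m
  ∣generatorBlock∣ i with i ≟ᶠ ℓ̂ | i ≟ᶠ zero
  ... | yes refl | yes ℓ̂≡0 = contradiction ℓ̂≡0 ℓ̂≢0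
  ... | yes _    | no _     = begin
    ∣ interval {t ^ r} 0 (t ^ ℓ) ∣ + 0 ≡⟨ +-identityʳ _ ⟩
    ∣ interval {t ^ r} 0 (t ^ ℓ) ∣     ≡⟨ ∣interval∣ {t ^ r} 0 (t ^ ℓ) ⟩
    t ^ ℓ ⊓ t ^ r                      ≡⟨ m≤n⇒m⊓n≡m tˡ≤tʳ ⟩
    t ^ ℓ                              ≡⟨ m∸n+n≡m tᵐ≤tˡ ⟨
    t ^ ℓ ∸ t ^ m + t ^ m              ∎
    where open ≡-Reasoning
  ... | no _     | yes _    = begin
    ∣ interval {t ^ r} 1 (t ^ m) ∣ + 1 ≡⟨ cong (_+ 1) (∣interval∣ {t ^ r} 1 (t ^ m)) ⟩
    t ^ m ⊓ t ^ r ∸ 1 + 1              ≡⟨ cong (λ k → k ∸ 1 + 1) (m≤n⇒m⊓n≡m tᵐ≤tʳ) ⟩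
    t ^ m ∸ 1 + 1                      ≡⟨ m∸n+n≡m (m^n>0 t m) ⟩
    t ^ m                              ∎
    where open ≡-Reasoning
  ... | no _     | no _     = trans (+-identityʳ _) (trans (∣interval∣ {t ^ r} 0 (t ^ m)) (m≤n⇒m⊓n≡m tᵐ≤tʳ))

  ∣S∣ : ∣ S ∣ ≡ t ^ ℓ + r-1 * t ^ m ∸ 1
  ∣S∣ = begin
    ∣ S ∣                                        ≡⟨ ∣concat-tabulate∣ generatorBlock ⟩
    sum B                                        ≡⟨ m+n∸n≡m (sum B) 1 ⟨
    sum B + 1 ∸ 1                                ≡⟨ cong (λ k → sum B + k ∸ 1) (sum-δ {r} zero 1) ⟨
    sum B + sum δ₀ ∸ 1                           ≡⟨ cong (_∸ 1) (∑-distrib-+ B δ₀) ⟨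
    sum (λ i → B i + δ₀ i) ∸ 1                   ≡⟨ cong (_∸ 1) (sum-cong-≗ ∣generatorBlock∣) ⟩
    sum (λ i → δℓ i + t ^ m) ∸ 1                 ≡⟨ cong (_∸ 1) (∑-distrib-+ {r} δℓ (λ _ → t ^ m)) ⟩
    sum δℓ + sum {r} (λ _ → t ^ m) ∸ 1           ≡⟨ cong₂ (λ a b → a + b ∸ 1) (sum-δ ℓ̂ _) (sum-const r (t ^ m)) ⟩
    t ^ ℓ ∸ t ^ m + (t ^ m + r-1 * t ^ m) ∸ 1    ≡⟨ cong (_∸ 1) (+-assoc (t ^ ℓ ∸ t ^ m) (t ^ m) _) ⟨
    t ^ ℓ ∸ t ^ m + t ^ m + r-1 * t ^ m ∸ 1      ≡⟨ cong (λ k → k + r-1 * t ^ m ∸ 1) (m∸n+n≡m tᵐ≤tˡ) ⟩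
    t ^ ℓ + r-1 * t ^ m ∸ 1                      ∎
    where
    open ≡-Reasoning
    B δ₀ δℓ : Fin r → ℕ
    B = ∣_∣ ∘ generatorBlock
    δ₀ i = if does (i ≟ᶠ zero) then 1 else 0
    δℓ i = if does (i ≟ᶠ ℓ̂) then t ^ ℓ ∸ t ^ m else 0

  m≤r : m ≤ r
  m≤r = <⇒≤ (<-trans m<ℓ ℓ<r)

  bigGenerator∈S : ∀ y → SupportedInLast zero ℓ y → code (ℓ̂ , y) ∈ S
  bigGenerator∈S y supp = ∈S⁺ ℓ̂ (funToFin y) (∈generatorBlock-ℓ̂ (funToFin y) (funToFin-< y (<⇒≤ ℓ<r) supp))

  smallGenerator∈S : ∀ i y → SupportedInLast zero m y → code (i , y) ≡ 1ᴮ ⊎ code (i , y) ∈ S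
  smallGenerator∈S i y supp with i ≟ᶠ ℓ̂ | i ≟ᶠ zero | 1 ≤? toℕ (funToFin y)
  ... | yes refl | _        | _       =
    inj₂ (bigGenerator∈S y (λ c c+ℓ<r → supp c (≤-<-trans (+-monoʳ-≤ (toℕ c) (<⇒≤ m<ℓ)) c+ℓ<r)))
  ... | no i≢ℓ̂  | _        | yes 1≤y =
    inj₂ (∈S⁺ i (funToFin y) (∈generatorBlock i (funToFin y) i≢ℓ̂ (funToFin-< y m≤r supp) (λ _ → 1≤y)))
  ... | no i≢ℓ̂  | no i≢0   | no _    =
    inj₂ (∈S⁺ i (funToFin y) (∈generatorBlock i (funToFin y) i≢ℓ̂ (funToFin-< y m≤r supp) (λ i≡0 → contradiction i≡0 i≢0)))
  ... | no _     | yes refl | no 1≰y  = inj₁ (code-cong {zero , y} {1ʷ} (refl , y≗zero))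
    where
    y≗zero : ∀ c → y c ≡ zero
    y≗zero c = trans (sym (finToFun-funToFin y c))
      (finToFun-supportedInLast {suc t-2} {r} {0} (funToFin y) (≰⇒> 1≰y) c (subst (_< r) (sym (+-identityʳ _)) (toℕ<n c)))

  1ᴮ∉S : 1ᴮ ∉ S
  1ᴮ∉S 1∈S = <⇒≱ (funToFin-< {w = 0} (λ (_ : Fin r) → zero {suc t-2}) z≤n (λ _ _ → refl))
                 (∈generatorBlock-zero _ (∈S⁻ zero (funToFin (λ (_ : Fin r) → zero)) 1∈S))

  weightᴳ-∈S : ∀ {s} → s ∈ S → weightᴳ s ≤ ℓ
  weightᴳ-∈S {s} s∈S = weight-supportedInLast (finToFun j)
    (finToFun-supportedInLast {suc t-2} {r} j (∈generatorBlock-< i j (∈S⁻ i j ij∈S)))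
    where
    i = quotient {r} (t ^ r) s
    j = remainder {r} (t ^ r) s
    ij∈S : combine i j ∈ S
    ij∈S = subst (_∈ S) (sym (combine-remQuot {r} (t ^ r) s)) s∈S

  toℕ-⊕ℓ̂ : ∀ α → toℕ α + ℓ < r → toℕ (α ⊕ ℓ̂) ≡ toℕ α + ℓ
  toℕ-⊕ℓ̂ α α+ℓ<r = trans (toℕ-⊕-< α ℓ̂ (subst (λ k → toℕ α + k < r) (sym (toℕ-fromℕ< ℓ<r)) α+ℓ<r))
                          (cong (toℕ α +_) (toℕ-fromℕ< ℓ<r))

  reachSuffix : ∀ x p → p ≤ q →
                Σ (Fin r) λ α → toℕ α ≡ p * ℓ × LazyWalk group S 1ᴮ p (code (α , suffix (toℕ α) x))
  reachSuffix x zero    _     =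
    zero , refl , subst (LazyWalk group S 1ᴮ 0) (code-cong {1ʷ} {zero , suffix 0 x} (refl , λ c → sym (suffix-zero x c))) []
  reachSuffix x (suc p) 1+p≤q with reachSuffix x p (≤-trans (n≤1+n p) 1+p≤q)
  ... | α , α≡pℓ , walk =
    α ⊕ ℓ̂ , toℕ-α⊕ℓ̂ , step walk (inj₂ (bigGenerator∈S x′ (suffix-supportedInLast ℓ _))) (begin
    code (α , suffix (toℕ α) x) · code (ℓ̂ , x′)    ≡⟨ code-homo (α , suffix (toℕ α) x) (ℓ̂ , x′) ⟩
    code ((α , suffix (toℕ α) x) ⋆ (ℓ̂ , x′))       ≡⟨ code-cong (suffix-extend α ℓ̂ ℓ x (<⇒≤ α+ℓ<r)) ⟩
    code (α ⊕ ℓ̂ , suffix (toℕ α + ℓ) x)            ≡⟨ cong (λ b → code (α ⊕ ℓ̂ , suffix b x)) (toℕ-⊕ℓ̂ α α+ℓ<r) ⟨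
    code (α ⊕ ℓ̂ , suffix (toℕ (α ⊕ ℓ̂)) x)          ∎)
    where
    open ≡-Reasoning
    x′ = suffix ℓ (λ d → x (d ⊕ (⊖ α)))
    α+ℓ≤qℓ : toℕ α + ℓ ≤ q * ℓ
    α+ℓ≤qℓ = subst (λ k → k + ℓ ≤ q * ℓ) (sym α≡pℓ) (subst (_≤ q * ℓ) (+-comm ℓ (p * ℓ)) (*-monoˡ-≤ ℓ 1+p≤q))
    α+ℓ<r : toℕ α + ℓ < r
    α+ℓ<r = ≤-<-trans α+ℓ≤qℓ qℓ<r
    toℕ-α⊕ℓ̂ : toℕ (α ⊕ ℓ̂) ≡ suc p * ℓ
    toℕ-α⊕ℓ̂ = trans (toℕ-⊕ℓ̂ α α+ℓ<r) (trans (cong (_+ ℓ) α≡pℓ) (+-comm (p * ℓ) ℓ))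

  reach : ∀ y → LazyWalk group S 1ᴮ (suc q) y
  reach y with reachSuffix (proj₂ (decode y)) q ≤-refl
  ... | α , α≡qℓ , walk = step walk (smallGenerator∈S j x′ (suffix-supportedInLast m _)) (begin
    code (α , suffix (toℕ α) x) · code (j , x′)  ≡⟨ code-homo (α , suffix (toℕ α) x) (j , x′) ⟩
    code ((α , suffix (toℕ α) x) ⋆ (j , x′))     ≡⟨ code-cong (suffix-extend α j m x (≤-reflexive α+m≡r)) ⟩
    code (α ⊕ j , suffix (toℕ α + m) x)          ≡⟨ code-cong (\\-leftDividesˡ α ι ,
                                                               suffix-full (≤-reflexive (sym α+m≡r)) x) ⟩
    code (ι , x)                                 ≡⟨ code-decode y ⟩
    y                                            ∎)
    where
    open ≡-Reasoning
    ι = proj₁ (decode y)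
    x = proj₂ (decode y)
    j = (⊖ α) ⊕ ι
    x′ = suffix m (λ d → x (d ⊕ (⊖ α)))
    α+m≡r : toℕ α + m ≡ r
    α+m≡r = trans (cong (_+ m) α≡qℓ) (sym r≡qℓ+m)

  target : Fin (r * t ^ r)
  target = code (zero , λ _ → suc zero)

  weightᴳ-step : ∀ g s → s ∈ S → weightᴳ (g · s) ≤ weightᴳ g + ℓ
  weightᴳ-step g s s∈S = ≤-trans (weightᴳ-· g s) (+-monoʳ-≤ (weightᴳ g) (weightᴳ-∈S s∈S))

  farFromIdentity : ∀ n → n < suc q → ¬ WalkOfLength group S n 1ᴮ target
  farFromIdentity n n<1+q walk = <⇒≱ qℓ<r (begin
    r                            ≡⟨ weight-≢𝟙 (λ (_ : Fin r) → suc zero) (λ _ ()) ⟨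
    weight {r} (λ _ → suc zero)  ≡⟨ weightᴳ-code (zero , λ _ → suc zero) ⟨
    weightᴳ target               ≤⟨ walk-potential group S weightᴳ ℓ weightᴳ-step walk ⟩
    weightᴳ 1ᴮ + n * ℓ           ≡⟨ cong (_+ n * ℓ) (trans (weightᴳ-code 1ʷ) (weight-𝟙 {r})) ⟩
    n * ℓ                        ≤⟨ *-monoˡ-≤ ℓ (≤-pred n<1+q) ⟩
    q * ℓ                        ∎)
    where open ≤-Reasoning

  hasDiameter : HasDiameter group S (suc q)
  hasDiameter = (λ g h → distAtMost-translate group S g h (lazyWalk⇒distAtMost group S (reach ((g ⁻¹ᴮ) · h))))
              , 1ᴮ , target , farFromIdentity

theorem3 : (k ℓ t m : ℕ) → 2 ≤ k → 2 ≤ ℓ → 2 ≤ t → 1 ≤ m → m < ℓ →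
    Σ (FinGroup) λ G → Σ (Subset (order G)) λ S →
      (ε G ∉ S) ×
      (∣ S ∣ ≡ t ^ ℓ + (((k ∸ 1) * ℓ + m) ∸ 1) * t ^ m ∸ 1) ×
      (order G ≡ ((k ∸ 1) * ℓ + m) * t ^ ((k ∸ 1) * ℓ + m)) ×
      HasDiameter G S k
theorem3 (suc (suc k-2)) ℓ (suc (suc t-2)) (suc m-1) (s≤s (s≤s _)) _ (s≤s (s≤s _)) (s≤s z≤n) m<ℓ
  rewrite +-suc (suc k-2 * ℓ) m-1 =
  group , S , 1ᴮ∉S , ∣S∣ , refl , hasDiameter
  where
  open Construction t-2 (suc k-2 * ℓ + m-1) (suc k-2) ℓ (suc m-1) (sym (+-suc (suc k-2 * ℓ) m-1)) (s≤s z≤n) (s≤s z≤n) m<ℓ
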